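{- Every $1$-perfect orientation of a connected graph has at most one sink.
   Context: All graphs are finite and simple. An orientation $D$ of a graph $G$ is $1$-perfect if for every vertex $v$, the out-neighborhood of $v$ in $D$ is a clique in $G$. A sink is a vertex of out-degree $0$. -}

module Defs where

open import Data.Nat using (ℕ)
open import Data.Fin using (Fin)
open import Data.Product using (_×_)
open import Data.Sum using (_⊎_)
open import Data.Empty using (⊥)
open import Relation.Nullary using (¬_)
open import Relation.Binary.PropositionalEquality using (_≡_)
open import Relation.Binary.Construct.Closure.ReflexiveTransitive using (Star)

record Graph (n : ℕ) : Set₁ where
  field
    Adj       : Fin n → Fin n → Set
    irrefl    : ∀ v → ¬ Adj v v
    sym       : ∀ {u v} → Adj u v → Adj v u

open Graph public

Connected : ∀ {n} → Graph n → Set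
Connected {n} G = ∀ (u v : Fin n) → Star (Adj G) u v

record Orientation {n : ℕ} (G : Graph n) : Set₁ where
  field
    Arc       : Fin n → Fin n → Set
    arc⇒adj   : ∀ {u v} → Arc u v → Adj G u v
    adj⇒arc   : ∀ {u v} → Adj G u v → Arc u v ⊎ Arc v u
    antisym   : ∀ {u v} → Arc u v → Arc v u → ⊥

open Orientation public

IsClique : ∀ {n} → Graph n → (Fin n → Set) → Set
IsClique {n} G S = ∀ (x y : Fin n) → S x → S y → ¬ x ≡ y → Adj G x y

OnePerfect : ∀ {n} {G : Graph n} → Orientation G → Set
OnePerfect {n} {G} D = ∀ (v : Fin n) → IsClique G (Arc D v)

IsSink : ∀ {n} {G : Graph n} → Orientation G → Fin n → Set
IsSink {n} D v = ∀ (w : Fin n) → ¬ Arc D v w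

module Submission where

-- Along a walk between two sinks some inner vertex has both its walk neighbours as
-- out-neighbours; these are adjacent (or equal) by 1-perfection, so the walk can be
-- shortened there. Hence a shortest walk between two sinks is empty.

open import Defs
open import Data.Nat using (ℕ; suc; _≤_; s≤s)
open import Data.Nat.Properties using (≤-refl; ≤-trans; n≤1+n)
open import Data.Fin using (Fin; _≟_)
open import Data.Product using (Σ-syntax; _,_)
open import Data.Sum using (inj₁; inj₂)
open import Data.Empty using (⊥-elim)
open import Relation.Nullary using (yes; no)
open import Relation.Binary.PropositionalEquality using (_≡_; refl)
open import Relation.Binary.Construct.Closure.ReflexiveTransitive using (Star; ε; _◅_)

length : ∀ {A : Set} {R : A → A → Set} {u v} → Star R u v → ℕ
length ε       = 0
length (_ ◅ w) = suc (length w)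

module _ {n} {G : Graph n} (D : Orientation G) (perfect : OnePerfect D) where

  Walk : Fin n → Fin n → Set
  Walk = Star (Adj G)

  -- Shortcut at the first vertex of the walk whose next edge points forward: it has both
  -- walk neighbours as out-neighbours.
  walk-from-arc-head : ∀ {a p t} → IsSink D t → Arc D a p → (w : Walk a t) →
                       Σ[ w′ ∈ Walk p t ] length w′ ≤ length w
  walk-from-arc-head sink-t a→p ε = ⊥-elim (sink-t _ a→p)
  walk-from-arc-head sink-t a→p (a~b ◅ w) with adj⇒arc D a~b
  ... | inj₂ b→a with walk-from-arc-head sink-t b→a w
  ...   | w′ , w′≤w = Graph.sym G (arc⇒adj D a→p) ◅ w′ , s≤s w′≤w
  walk-from-arc-head {a} {p} sink-t a→p (_◅_ {j = b} a~b w) | inj₁ a→b with p ≟ b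
  ... | yes refl = w , n≤1+n (length w)
  ... | no p≢b   = perfect a p b a→p a→b p≢b ◅ w , ≤-refl

  sinks-joined-by-short-walk-equal : ∀ {s t} → IsSink D s → IsSink D t →
                                     ∀ k (w : Walk s t) → length w ≤ k → s ≡ t
  sinks-joined-by-short-walk-equal sink-s sink-t k ε _ = refl
  sinks-joined-by-short-walk-equal sink-s sink-t (suc k) (s~b ◅ w) (s≤s w≤k) with adj⇒arc D s~b
  ... | inj₁ s→b = ⊥-elim (sink-s _ s→b)
  ... | inj₂ b→s with walk-from-arc-head sink-t b→s w
  ...   | w′ , w′≤w = sinks-joined-by-short-walk-equal sink-s sink-t k w′ (≤-trans w′≤w w≤k)

lemma9 : ∀ {n : ℕ} (G : Graph n) → Connected G → (D : Orientation G) → OnePerfect D →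
           ∀ (s t : Fin n) → IsSink D s → IsSink D t → s ≡ t
lemma9 G connected D perfect s t sink-s sink-t =
  sinks-joined-by-short-walk-equal D perfect sink-s sink-t _ (connected s t) ≤-refl
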